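{- There is no distributive law $A\circ L\Rightarrow L\circ A$, where $A$ is the Abelian group monad and $L$ is the list monad on $\mathbf{Set}$.
   Context: A monad on $\mathbf{Set}$ is $\langle T,\eta,\mu\rangle$ with $\mu\cdot T\eta=\mathrm{id}=\mu\cdot\eta T$, $\mu\cdot T\mu=\mu\cdot\mu T$. The list monad $L$ sends $X$ to the set of finite lists over $X$, with unit the singleton list and multiplication concatenation of a list of lists (it is presented by the theory of monoids). The Abelian group monad $A$ sends $X$ to the set of finitely supported functions $X\to\mathbb{Z}$ (formal $\mathbb Z$-linear combinations of elements of $X$), with unit $x\mapsto 1\cdot x$ and multiplication taking the sum with multiplied coefficients (it is presented by the theory of Abelian groups). A distributive law $S\circ T\Rightarrow T\circ S$ is a natural transformation $\lambda:ST\Rightarrow TS$ with $\lambda\cdot\eta^S T=T\eta^S$, $\lambda\cdot S\eta^T=\eta^T S$, $\lambda\cdot\mu^S T=T\mu^S\cdot\lambda S\cdot S\lambda$, $\lambda\cdot S\mu^T=\mu^T S\cdot T\lambda\cdot\lambda T$. -}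

module Defs where

-- Monads on Set are modelled on the category of setoids (the standard
-- constructive model of Set, where quotients such as the free Abelian group
-- are available).  Morphisms are setoid maps (Func); naturality and the
-- distributive-law equations hold up to the setoid equality of the target.

open import Level using (0ℓ)
open import Data.Integer using (ℤ; _+_; _*_; 0ℤ; 1ℤ)
open import Data.Product using (_×_; _,_; proj₁; proj₂)
open import Data.List using (List; []; _∷_; [_]; map; concat; concatMap)
open import Relation.Binary.Bundles using (Setoid)
open import Relation.Binary.Core using (Rel)
open import Relation.Binary.PropositionalEquality using (_≡_)
open import Function.Bundles using (Func)
import Data.List.Relation.Binary.Pointwise as PW

L : Setoid 0ℓ 0ℓ → Setoid 0ℓ 0ℓ
L S = PW.setoid S

Lmap : {X Y : Set} → (X → Y) → List X → List Y
Lmap = map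

ηL : {X : Set} → X → List X
ηL x = [ x ]

μL : {X : Set} → List (List X) → List X
μL = concat

-- The Abelian group monad A: formal Z-linear combinations of elements,
-- represented by lists of (coefficient , element), quotiented by the
-- congruence generated by reordering, merging equal terms and deleting
-- zero terms.  The quotient is exactly the set of finitely supported
-- functions X → ℤ (the free Abelian group on X).

module _ (S : Setoid 0ℓ 0ℓ) where
  open Setoid S renaming (Carrier to C; _≈_ to _≈S_)

  data _∼_ : Rel (List (ℤ × C)) 0ℓ where
    ∼-refl  : ∀ {xs} → xs ∼ xs
    ∼-sym   : ∀ {xs ys} → xs ∼ ys → ys ∼ xs
    ∼-trans : ∀ {xs ys zs} → xs ∼ ys → ys ∼ zs → xs ∼ zs
    ∼-cons  : ∀ {c d x y xs ys} → c ≡ d → x ≈S y → xs ∼ ys →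
              ((c , x) ∷ xs) ∼ ((d , y) ∷ ys)
    ∼-swap  : ∀ {p q xs} → (p ∷ q ∷ xs) ∼ (q ∷ p ∷ xs)
    ∼-merge : ∀ {c d x xs} → ((c , x) ∷ (d , x) ∷ xs) ∼ ((c + d , x) ∷ xs)
    ∼-zero  : ∀ {x xs} → ((0ℤ , x) ∷ xs) ∼ xs

  A : Setoid 0ℓ 0ℓ
  A = record
    { Carrier = List (ℤ × C)
    ; _≈_ = _∼_
    ; isEquivalence = record { refl = ∼-refl ; sym = ∼-sym ; trans = ∼-trans }
    }

Amap : {X Y : Set} → (X → Y) → List (ℤ × X) → List (ℤ × Y)
Amap f = map (λ p → (proj₁ p , f (proj₂ p)))

ηA : {X : Set} → X → List (ℤ × X)
ηA x = [ (1ℤ , x) ]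

μA : {X : Set} → List (ℤ × List (ℤ × X)) → List (ℤ × X)
μA = concatMap (λ p → map (λ q → (proj₁ p * proj₁ q , proj₂ q)) (proj₂ p))

Car : Setoid 0ℓ 0ℓ → Set
Car = Setoid.Carrier

record DistLawAL : Set₁ where
  field
    lam : (S : Setoid 0ℓ 0ℓ) → Car (A (L S)) → Car (L (A S))
    lam-cong : (S : Setoid 0ℓ 0ℓ) {u v : Car (A (L S))} →
               Setoid._≈_ (A (L S)) u v →
               Setoid._≈_ (L (A S)) (lam S u) (lam S v)
    natural : (S T : Setoid 0ℓ 0ℓ) (f : Func S T) (u : Car (A (L S))) →
              Setoid._≈_ (L (A T))
                (Lmap (Amap (Func.to f)) (lam S u))
                (lam T (Amap (Lmap (Func.to f)) u))
    unit-A : (S : Setoid 0ℓ 0ℓ) (xs : Car (L S)) →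
             Setoid._≈_ (L (A S)) (lam S (ηA xs)) (Lmap ηA xs)
    unit-L : (S : Setoid 0ℓ 0ℓ) (a : Car (A S)) →
             Setoid._≈_ (L (A S)) (lam S (Amap ηL a)) (ηL a)
    mult-A : (S : Setoid 0ℓ 0ℓ) (t : Car (A (A (L S)))) →
             Setoid._≈_ (L (A S))
               (lam S (μA t))
               (Lmap μA (lam (A S) (Amap (lam S) t)))
    mult-L : (S : Setoid 0ℓ 0ℓ) (t : Car (A (L (L S)))) →
             Setoid._≈_ (L (A S))
               (lam S (Amap μL t))
               (μL (Lmap (lam S) (lam (L S) t)))

-- A distributive law λ must send the formal sum 1·[] to the empty list and the zero sum
-- to the one-element list [0].  The multiplication law for A at 1·(1·[]) + 1·0 gives
-- λ(1·[] + 1·[0]) = []; naturality along constant maps and the multiplication law for L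
-- upgrade this to λ(1·[] + 1·ys) = [] for every list ys.  Now 1·[] − 1·[] = 0, yet the
-- multiplication law for A at 1·(1·[]) + 1·(−1·[]) makes the length of λ(1·[] − 1·[]) that of
-- λ(1·[] + 1·λ(−1·[])), which is 0, whereas λ(0) = [0] has length 1.
module Submission where

open import Level using (0ℓ)
open import Data.Unit using (⊤)
open import Data.Integer using (ℤ; 1ℤ; -1ℤ)
open import Data.Nat.Properties using (1+n≢0)
open import Data.Product using (_×_; _,_)
open import Data.List using (List; []; _∷_; [_]; length)
open import Data.List.Properties using (length-map; ++-identityʳ)
open import Data.List.Relation.Binary.Pointwise using (Pointwise-length)
open import Relation.Binary.Bundles using (Setoid)
open import Relation.Binary.PropositionalEquality as ≡ using (_≡_; refl; sym; trans)
open import Relation.Nullary using (¬_)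
open import Function.Bundles using (Func)
import Function.Construct.Constant as Constant
open import Defs

nil-plus : {C : Set} → List C → List (ℤ × List C)
nil-plus ys = (1ℤ , []) ∷ (1ℤ , ys) ∷ []

length-nil : {C : Set} (xs : List C) → length xs ≡ 0 → xs ≡ []
length-nil [] _ = refl

module DistLawProperties (D : DistLawAL) where
  open DistLawAL D
  open Setoid using (_≈_)

  length-lam-cong : ∀ S {u v} → _≈_ (A (L S)) u v → length (lam S u) ≡ length (lam S v)
  length-lam-cong S u≈v = Pointwise-length (lam-cong S u≈v)

  length-lam-natural : ∀ S T (f : Func S T) u →
                       length (lam S u) ≡ length (lam T (Amap (Lmap (Func.to f)) u))
  length-lam-natural S T f u =
    trans (sym (length-map (Amap (Func.to f)) (lam S u))) (Pointwise-length (natural S T f u))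

  length-lam-μA : ∀ S t → length (lam S (μA t)) ≡ length (lam (A S) (Amap (lam S) t))
  length-lam-μA S t =
    trans (Pointwise-length (mult-A S t)) (length-map μA (lam (A S) (Amap (lam S) t)))

  length-lam-zero : ∀ S → length (lam S []) ≡ 1
  length-lam-zero S = Pointwise-length (unit-L S [])

  length-lam-nil : ∀ S → length (lam S [ (1ℤ , []) ]) ≡ 0
  length-lam-nil S = Pointwise-length (unit-A S [])

  length-lam-nil-plus-zero : ∀ S → length (lam (A S) (nil-plus [ [] ])) ≡ 0
  length-lam-nil-plus-zero S = begin
    length (lam (A S) (nil-plus [ [] ]))     ≡⟨ sym (length-lam-cong (A S) lam-t≈nil-plus-zero) ⟩
    length (lam (A S) (Amap (lam S) t))      ≡⟨ sym (length-lam-μA S t) ⟩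
    length (lam S [ (1ℤ , []) ])             ≡⟨ length-lam-nil S ⟩
    0                                        ∎
    where
    open ≡.≡-Reasoning
    t : Car (A (A (L S)))
    t = (1ℤ , [ (1ℤ , []) ]) ∷ (1ℤ , []) ∷ []
    lam-t≈nil-plus-zero : _≈_ (A (L (A S))) (Amap (lam S) t) (nil-plus [ [] ])
    lam-t≈nil-plus-zero = ∼-cons refl (unit-A S []) (∼-cons refl (unit-L S []) ∼-refl)

  length-lam-nil-plus-singleton : ∀ S (s : Car S) → length (lam S (nil-plus [ s ])) ≡ 0
  length-lam-nil-plus-singleton S s =
    trans (sym (length-lam-natural (A S) S (Constant.function (A S) S s) (nil-plus [ [] ])))
          (length-lam-nil-plus-zero S)

  lam-nil-plus : ∀ S (ys : List (Car S)) → lam S (nil-plus ys) ≡ []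
  lam-nil-plus S ys = length-nil (lam S (nil-plus ys)) (begin
    length (lam S (nil-plus ys))                                ≡⟨ length-lam-cong S nil-plus≈μL ⟩
    length (lam S (Amap μL (nil-plus [ ys ])))                  ≡⟨ Pointwise-length (mult-L S (nil-plus [ ys ])) ⟩
    length (μL (Lmap (lam S) (lam (L S) (nil-plus [ ys ]))))    ≡⟨ ≡.cong (λ zs → length (μL (Lmap (lam S) zs))) lam-nil-plus-singleton ⟩
    0                                                           ∎)
    where
    open ≡.≡-Reasoning
    nil-plus≈μL : _≈_ (A (L S)) (nil-plus ys) (Amap μL (nil-plus [ ys ]))
    nil-plus≈μL = ∼-cons refl (Setoid.refl (L S))
                    (∼-cons refl (Setoid.reflexive (L S) (sym (++-identityʳ ys))) ∼-refl)
    lam-nil-plus-singleton : lam (L S) (nil-plus [ ys ]) ≡ []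
    lam-nil-plus-singleton =
      length-nil (lam (L S) (nil-plus [ ys ])) (length-lam-nil-plus-singleton (L S) ys)

  length-lam-nil-minus-nil : ∀ S → length (lam S ((1ℤ , []) ∷ (-1ℤ , []) ∷ [])) ≡ 0
  length-lam-nil-minus-nil S = begin
    length (lam S (μA t))                                 ≡⟨ length-lam-μA S t ⟩
    length (lam (A S) (Amap (lam S) t))                   ≡⟨ length-lam-cong (A S) (∼-cons refl (unit-A S []) ∼-refl) ⟩
    length (lam (A S) (nil-plus (lam S [ (-1ℤ , []) ])))  ≡⟨ ≡.cong length (lam-nil-plus (A S) _) ⟩
    0                                                     ∎
    where
    open ≡.≡-Reasoning
    t : Car (A (A (L S)))
    t = (1ℤ , [ (1ℤ , []) ]) ∷ (1ℤ , [ (-1ℤ , []) ]) ∷ []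

mainTheorem18 : ¬ DistLawAL
mainTheorem18 D = 1+n≢0 (begin
  1                                                ≡⟨ sym (length-lam-zero S) ⟩
  length (lam S [])                                ≡⟨ length-lam-cong S (∼-trans ∼-merge ∼-zero) ⟨
  length (lam S ((1ℤ , []) ∷ (-1ℤ , []) ∷ []))     ≡⟨ length-lam-nil-minus-nil S ⟩
  0                                                ∎)
  where
  open DistLawAL D
  open DistLawProperties D
  open ≡.≡-Reasoning
  S : Setoid 0ℓ 0ℓ
  S = ≡.setoid ⊤
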